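{- Let $F_n(x,y)$ denote the bivariate Fibonacci polynomials. Let $r\ge 1$ and $n\ge 0$ be integers. Then \[ \frac{\partial^{r}F_{n+1}(x,y)}{\partial x^{r}}= \begin{cases} 0, & n<r,\\[2pt] r!, & n=r,\\[2pt] \dfrac{1}{n-r}\left[n x\,\dfrac{\partial^{r}F_{n}(x,y)}{\partial x^{r}}+y(n+r)\,\dfrac{\partial^{r}F_{n-1}(x,y)}{\partial x^{r}}\right], & n>r. \end{cases} \]
   Context: The bivariate Fibonacci polynomials $F_n(x,y)\in\mathbb{Z}[x,y]$, $n\ge 0$, are defined by $F_0(x,y)=0$, $F_1(x,y)=1$ and $F_n(x,y)=xF_{n-1}(x,y)+yF_{n-2}(x,y)$ for $n\ge 2$. -}

module Defs where

open import Data.Nat as ℕ using (ℕ; zero; suc)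
open import Data.Integer as ℤ using (ℤ; +_)
open import Relation.Binary.PropositionalEquality using (_≡_)

-- A bivariate polynomial (more generally, formal power series) over ℤ,
-- given by its coefficient function: p i j is the coefficient of x^i y^j.
-- ℤ[x,y] embeds into this ring, and all operations below are the usual ones.
Poly : Set
Poly = ℕ → ℕ → ℤ

infix 4 _≈_
_≈_ : Poly → Poly → Set
p ≈ q = ∀ i j → p i j ≡ q i j

const : ℤ → Poly
const c zero zero = c
const c _    _    = + 0

0P : Poly
0P = const (+ 0)

1P : Poly
1P = const (+ 1)

infixl 6 _⊕_
_⊕_ : Poly → Poly → Poly
(p ⊕ q) i j = p i j ℤ.+ q i j

infixl 7 _·_
_·_ : ℤ → Poly → Poly
(c · p) i j = c ℤ.* p i j

X* : Poly → Poly
X* p zero    j = + 0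
X* p (suc i) j = p i j

Y* : Poly → Poly
Y* p i zero    = + 0
Y* p i (suc j) = p i j

∂x : Poly → Poly
∂x p i j = (+ suc i) ℤ.* p (suc i) j

∂x^ : ℕ → Poly → Poly
∂x^ zero    p = p
∂x^ (suc r) p = ∂x (∂x^ r p)

F : ℕ → Poly
F zero          = 0P
F (suc zero)    = 1P
F (suc (suc n)) = X* (F (suc n)) ⊕ Y* (F n)

module Submission where

-- All polynomials in the theorem have natural-number coefficients, so the
-- proof is a computation of coefficients followed by coefficient identities.
--
-- The coefficient of x^i y^j vanishes unless n = 1 + i + 2j
--    (fib-support); on that diagonal it is the binomial number (i+j choose i),
--    recorded without division as  fib (1+i+2j) i j · i! · j! = (i+j)!
--    (pascal-factorial, from Pascal's rule).
--  * ∂ₓʳ moves the coefficient of x^(i+r) y^j to x^i y^j, multiplied by the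
--    rising factorial (i+1)⋯(i+r) (∂x^-coeff).  So ∂ₓʳ F (n+1) is supported on
--    n = i + r + 2j (dfib-support), where its coefficient times i! j! is
--    (i+r+j)! (dfib-diagonal).
--  * The cases n < r and n = r of the theorem are support/value statements.
--    The recurrence holds for every n (dfib-recurrence): off the diagonal all
--    terms vanish, and on it, after multiplying by i! j! and dividing by
--    (i+r+j-1)!, it becomes
--    (i+2j)(i+r+j) = n·i + (n+r)·j  for n = i + r + 2j.

open import Defs
open import Data.Nat using (ℕ; zero; suc; s≤s; z≤n; _<_; _≤_; _∸_; _+_; _*_; _!)
open import Data.Nat.Properties
  using ( +-suc; +-comm; +-identityʳ; *-identityʳ; *-zeroʳ; *-assoc; *-cancelʳ-≡
        ; _!*_!≢0; _≟_; suc-injective; m+n∸m≡n; <⇒≢; <⇒≱; m<m+n; m≤m+n; m≤n+m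
        ; ≤-trans; <-≤-trans )
open import Data.Nat.Tactic.RingSolver using (solve-∀)
open import Data.Integer as ℤ using (+_)
open import Data.Integer.Properties using (pos-+; pos-*; *-identityˡ)
  renaming (*-assoc to ℤ*-assoc)
open import Relation.Binary.PropositionalEquality
open import Relation.Nullary using (yes; no)
open import Data.Empty using (⊥-elim)
open import Data.Product using (_×_; _,_)

NPoly : Set
NPoly = ℕ → ℕ → ℕ

⌜_⌝ : NPoly → Poly
⌜ g ⌝ i j = + g i j

Xₙ : NPoly → NPoly
Xₙ g zero    j = 0
Xₙ g (suc i) j = g i j

Yₙ : NPoly → NPoly
Yₙ g i zero    = 0
Yₙ g i (suc j) = g i j

X*-natural : ∀ {p g} → p ≈ ⌜ g ⌝ → X* p ≈ ⌜ Xₙ g ⌝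
X*-natural p≈g zero    j = refl
X*-natural p≈g (suc i) j = p≈g i j

Y*-natural : ∀ {p g} → p ≈ ⌜ g ⌝ → Y* p ≈ ⌜ Yₙ g ⌝
Y*-natural p≈g i zero    = refl
Y*-natural p≈g i (suc j) = p≈g i j

diagonal-step : ∀ i j → i + suc j + suc j ≡ suc (suc (i + j + j))
diagonal-step = solve-∀

fib : ℕ → NPoly
fib zero          i    j    = 0
fib (suc zero)    zero zero = 1
fib (suc zero)    _    _    = 0
fib (suc (suc n)) i    j    = Xₙ (fib (suc n)) i j + Yₙ (fib n) i j

fib-coeff : ∀ n → F n ≈ ⌜ fib n ⌝
fib-coeff zero          zero    zero    = refl
fib-coeff zero          zero    (suc j) = refl
fib-coeff zero          (suc i) j       = refl
fib-coeff (suc zero)    zero    zero    = refl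
fib-coeff (suc zero)    zero    (suc j) = refl
fib-coeff (suc zero)    (suc i) j       = refl
fib-coeff (suc (suc n)) i       j       =
  trans (cong₂ ℤ._+_ (X*-natural (fib-coeff (suc n)) i j) (Y*-natural (fib-coeff n) i j))
        (sym (pos-+ (Xₙ (fib (suc n)) i j) (Yₙ (fib n) i j)))

fib-support : ∀ n i j → n ≢ suc (i + j + j) → fib n i j ≡ 0
fib-support zero          i       j       _  = refl
fib-support (suc zero)    zero    zero    ne = ⊥-elim (ne refl)
fib-support (suc zero)    zero    (suc j) _  = refl
fib-support (suc zero)    (suc i) j       _  = refl
fib-support (suc (suc n)) i       j       ne = cong₂ _+_ (x-part i ne) (y-part j ne)
  where
  x-part : ∀ i → suc (suc n) ≢ suc (i + j + j) → Xₙ (fib (suc n)) i j ≡ 0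
  x-part zero    _   = refl
  x-part (suc i) ne′ = fib-support (suc n) i j (λ e → ne′ (cong suc e))
  y-part : ∀ j → suc (suc n) ≢ suc (i + j + j) → Yₙ (fib n) i j ≡ 0
  y-part zero    _   = refl
  y-part (suc j) ne′ = fib-support n i j (λ e → ne′ (cong suc (trans (cong suc e) (sym (diagonal-step i j)))))

pascal : ℕ → ℕ → ℕ
pascal i j = fib (suc (i + j + j)) i j

pascal-left : ∀ i → pascal (suc i) zero ≡ pascal i zero
pascal-left i = +-identityʳ (pascal i zero)

pascal-top : ∀ j → pascal zero (suc j) ≡ pascal zero j
pascal-top j = cong (λ m → fib m zero j) (+-suc j j)

pascal-rule : ∀ i j → pascal (suc i) (suc j) ≡ pascal i (suc j) + pascal (suc i) j
pascal-rule i j = cong (λ m → pascal i (suc j) + fib m (suc i) j) (diagonal-step i j)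

-- pascal i j is the binomial number (i+j choose i), stated without division.
pascal-factorial : ∀ i j → pascal i j * (i ! * j !) ≡ (i + j) !
pascal-factorial zero    zero    = refl
pascal-factorial (suc i) zero    = begin
  pascal (suc i) 0 * (suc i ! * 1)   ≡⟨ cong (_* (suc i ! * 1)) (pascal-left i) ⟩
  pascal i 0 * (suc i * i ! * 1)     ≡⟨ pull-out (pascal i 0) (i !) i ⟩
  suc i * (pascal i 0 * (i ! * 1))   ≡⟨ cong (suc i *_) (pascal-factorial i 0) ⟩
  suc i * (i + 0) !                  ≡⟨ cong (λ k → suc k * (i + 0) !) (sym (+-identityʳ i)) ⟩
  (suc i + 0) !                      ∎
  where
  open ≡-Reasoning
  pull-out : ∀ a b c → a * (suc c * b * 1) ≡ suc c * (a * (b * 1))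
  pull-out = solve-∀
pascal-factorial zero    (suc j) = begin
  pascal 0 (suc j) * (1 * suc j !)   ≡⟨ cong (_* (1 * suc j !)) (pascal-top j) ⟩
  pascal 0 j * (1 * (suc j * j !))   ≡⟨ pull-out (pascal 0 j) (j !) j ⟩
  suc j * (pascal 0 j * (1 * j !))   ≡⟨ cong (suc j *_) (pascal-factorial 0 j) ⟩
  suc j !                            ∎
  where
  open ≡-Reasoning
  pull-out : ∀ a b c → a * (1 * (suc c * b)) ≡ suc c * (a * (1 * b))
  pull-out = solve-∀
pascal-factorial (suc i) (suc j) = begin
  pascal (suc i) (suc j) * (suc i ! * suc j !)
    ≡⟨ cong (_* (suc i ! * suc j !)) (pascal-rule i j) ⟩
  (A + B) * (suc i * i ! * (suc j * j !))
    ≡⟨ split A B (i !) (j !) i j ⟩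
  suc i * (A * (i ! * suc j !)) + suc j * (B * (suc i ! * j !))
    ≡⟨ cong₂ (λ a b → suc i * a + suc j * b) (pascal-factorial i (suc j)) (pascal-factorial (suc i) j) ⟩
  suc i * (i + suc j) ! + suc j * (suc i + j) !
    ≡⟨ cong (λ k → suc i * (i + suc j) ! + suc j * k !) (sym (+-suc i j)) ⟩
  suc i * (i + suc j) ! + suc j * (i + suc j) !
    ≡⟨ collect ((i + suc j) !) i j ⟩
  (suc i + suc j) !
    ∎
  where
  open ≡-Reasoning
  A = pascal i (suc j)
  B = pascal (suc i) j
  split : ∀ a b p q i j → (a + b) * (suc i * p * (suc j * q))
                          ≡ suc i * (a * (p * (suc j * q))) + suc j * (b * (suc i * p * q))
  split = solve-∀
  collect : ∀ k i j → suc i * k + suc j * k ≡ suc (i + suc j) * k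
  collect = solve-∀

-- The rising factorial (i+1)(i+2)⋯(i+r): the factor picked up by x^(i+r)
-- under r derivatives.
rising : ℕ → ℕ → ℕ
rising i zero    = 1
rising i (suc r) = suc i * rising (suc i) r

rising-factorial : ∀ i r → rising i r * i ! ≡ (i + r) !
rising-factorial i zero    = trans (+-identityʳ (i !)) (cong _! (sym (+-identityʳ i)))
rising-factorial i (suc r) = begin
  suc i * rising (suc i) r * i !   ≡⟨ regroup i (rising (suc i) r) (i !) ⟩
  rising (suc i) r * suc i !       ≡⟨ rising-factorial (suc i) r ⟩
  (suc i + r) !                    ≡⟨ cong _! (sym (+-suc i r)) ⟩
  (i + suc r) !                    ∎
  where
  open ≡-Reasoning
  regroup : ∀ a b c → suc a * b * c ≡ b * (suc a * c)
  regroup = solve-∀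

∂x^-coeff : ∀ r p i j → ∂x^ r p i j ≡ + rising i r ℤ.* p (i + r) j
∂x^-coeff zero    p i j = trans (cong (λ k → p k j) (sym (+-identityʳ i))) (sym (*-identityˡ _))
∂x^-coeff (suc r) p i j = begin
  + suc i ℤ.* ∂x^ r p (suc i) j
    ≡⟨ cong (+ suc i ℤ.*_) (∂x^-coeff r p (suc i) j) ⟩
  + suc i ℤ.* (+ rising (suc i) r ℤ.* p (suc i + r) j)
    ≡⟨ sym (ℤ*-assoc (+ suc i) (+ rising (suc i) r) _) ⟩
  + suc i ℤ.* + rising (suc i) r ℤ.* p (suc i + r) j
    ≡⟨ cong₂ ℤ._*_ (sym (pos-* (suc i) (rising (suc i) r))) (cong (λ k → p k j) (sym (+-suc i r))) ⟩
  + rising i (suc r) ℤ.* p (i + suc r) j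
    ∎
  where open ≡-Reasoning

dfib : ℕ → ℕ → NPoly
dfib r m i j = rising i r * fib m (i + r) j

dfib-coeff : ∀ r m → ∂x^ r (F m) ≈ ⌜ dfib r m ⌝
dfib-coeff r m i j = begin
  ∂x^ r (F m) i j                        ≡⟨ ∂x^-coeff r (F m) i j ⟩
  + rising i r ℤ.* F m (i + r) j         ≡⟨ cong (+ rising i r ℤ.*_) (fib-coeff m (i + r) j) ⟩
  + rising i r ℤ.* + fib m (i + r) j     ≡⟨ sym (pos-* (rising i r) (fib m (i + r) j)) ⟩
  + dfib r m i j                         ∎
  where open ≡-Reasoning

shifted-coeff : ∀ r n → ∂x^ r (F (n + 1)) ≈ ⌜ dfib r (suc n) ⌝
shifted-coeff r n i j = trans (dfib-coeff r (n + 1) i j) (cong (λ m → + dfib r m i j) (+-comm n 1))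

dfib-support : ∀ r m i j → m ≢ suc (i + r + j + j) → dfib r m i j ≡ 0
dfib-support r m i j ne = trans (cong (rising i r *_) (fib-support m (i + r) j ne)) (*-zeroʳ (rising i r))

dfib-diagonal : ∀ r i j → dfib r (suc (i + r + j + j)) i j * (i ! * j !) ≡ (i + r + j) !
dfib-diagonal r i j = begin
  rising i r * pascal (i + r) j * (i ! * j !)   ≡⟨ regroup (rising i r) (pascal (i + r) j) (i !) (j !) ⟩
  pascal (i + r) j * (rising i r * i ! * j !)   ≡⟨ cong (λ k → pascal (i + r) j * (k * j !)) (rising-factorial i r) ⟩
  pascal (i + r) j * ((i + r) ! * j !)          ≡⟨ pascal-factorial (i + r) j ⟩
  (i + r + j) !                                 ∎
  where
  open ≡-Reasoning
  regroup : ∀ a b c d → a * b * (c * d) ≡ b * (a * c * d)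
  regroup = solve-∀

≤-diagonal : ∀ i r j → r ≤ i + r + j + j
≤-diagonal i r j = ≤-trans (m≤n+m r i) (≤-trans (m≤m+n (i + r) j) (m≤m+n (i + r + j) j))

x-neighbour : ∀ r i j → Xₙ (dfib (suc r) (i + suc r + j + j)) i j * (i ! * j !) ≡ i * (i + r + j) !
x-neighbour r zero    j = refl
x-neighbour r (suc i) j = begin
  D * (suc i * i ! * j !)     ≡⟨ pull-out D (i !) (j !) i ⟩
  suc i * (D * (i ! * j !))   ≡⟨ cong (suc i *_) (dfib-diagonal (suc r) i j) ⟩
  suc i * (i + suc r + j) !   ≡⟨ cong (λ k → suc i * (k + j) !) (+-suc i r) ⟩
  suc i * (suc i + r + j) !   ∎
  where
  open ≡-Reasoning
  D = dfib (suc r) (suc (i + suc r + j + j)) i j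
  pull-out : ∀ a b c i → a * (suc i * b * c) ≡ suc i * (a * (b * c))
  pull-out = solve-∀

y-neighbour : ∀ r i j → Yₙ (dfib (suc r) (i + suc r + j + j ∸ 1)) i j * (i ! * j !) ≡ j * (i + r + j) !
y-neighbour r i zero    = refl
y-neighbour r i (suc j) = begin
  dfib (suc r) (i + suc r + suc j + suc j ∸ 1) i j * (i ! * suc j !)
    ≡⟨ cong (λ m → dfib (suc r) (m ∸ 1) i j * (i ! * suc j !)) (diagonal-step (i + suc r) j) ⟩
  D * (i ! * (suc j * j !))
    ≡⟨ pull-out D (i !) (j !) j ⟩
  suc j * (D * (i ! * j !))
    ≡⟨ cong (suc j *_) (dfib-diagonal (suc r) i j) ⟩
  suc j * (i + suc r + j) !
    ≡⟨ cong (λ k → suc j * k !) (shift i r j) ⟩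
  suc j * (i + r + suc j) !
    ∎
  where
  open ≡-Reasoning
  D = dfib (suc r) (suc (i + suc r + j + j)) i j
  pull-out : ∀ a b c j → a * (b * (suc j * c)) ≡ suc j * (a * (b * c))
  pull-out = solve-∀
  shift : ∀ i r j → i + suc r + j ≡ i + r + suc j
  shift = solve-∀

recurrence-on-diagonal : ∀ r i j → let n = i + suc r + j + j in
  (n ∸ suc r) * dfib (suc r) (suc n) i j
    ≡ n * Xₙ (dfib (suc r) n) i j + (n + suc r) * Yₙ (dfib (suc r) (n ∸ 1)) i j
recurrence-on-diagonal r i j = *-cancelʳ-≡ _ _ P {{i !* j !≢0}} (begin
  (n ∸ suc r) * D * P              ≡⟨ cong (λ k → k * D * P) n∸r ⟩
  (i + j + j) * D * P              ≡⟨ *-assoc (i + j + j) D P ⟩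
  (i + j + j) * (D * P)            ≡⟨ cong ((i + j + j) *_) (dfib-diagonal (suc r) i j) ⟩
  (i + j + j) * (i + suc r + j) !  ≡⟨ cong (λ k → (i + j + j) * (k + j) !) (+-suc i r) ⟩
  (i + j + j) * (suc (i + r + j) * M)
    ≡⟨ key-identity i j r M ⟩
  n * (i * M) + (n + suc r) * (j * M)
    ≡⟨ sym (cong₂ (λ a b → n * a + (n + suc r) * b) (x-neighbour r i j) (y-neighbour r i j)) ⟩
  n * (X * P) + (n + suc r) * (Y * P)
    ≡⟨ factor n (suc r) X Y P ⟩
  (n * X + (n + suc r) * Y) * P    ∎)
  where
  open ≡-Reasoning
  n = i + suc r + j + j
  P = i ! * j !
  M = (i + r + j) !
  D = dfib (suc r) (suc n) i j
  X = Xₙ (dfib (suc r) n) i j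
  Y = Yₙ (dfib (suc r) (n ∸ 1)) i j
  n∸r : n ∸ suc r ≡ i + j + j
  n∸r = trans (cong (_∸ suc r) (reorder i j (suc r))) (m+n∸m≡n (suc r) (i + j + j))
    where
    reorder : ∀ i j r → i + r + j + j ≡ r + (i + j + j)
    reorder = solve-∀
  key-identity : ∀ i j r M → (i + j + j) * (suc (i + r + j) * M)
    ≡ (i + suc r + j + j) * (i * M) + (i + suc r + j + j + suc r) * (j * M)
  key-identity = solve-∀
  factor : ∀ n s x y p → n * (x * p) + (n + s) * (y * p) ≡ (n * x + (n + s) * y) * p
  factor = solve-∀

-- Off the diagonal every term of the recurrence vanishes.
recurrence-off-diagonal : ∀ r n i j → n ≢ i + r + j + j →
  (n ∸ r) * dfib r (suc n) i j ≡ n * Xₙ (dfib r n) i j + (n + r) * Yₙ (dfib r (n ∸ 1)) i j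
recurrence-off-diagonal r n i j ne =
  all-zero (n ∸ r) n (n + r) (dfib-support r (suc n) i j (λ e → ne (suc-injective e))) (x-part i ne) (y-part j ne)
  where
  all-zero : ∀ {a b c} k l m → a ≡ 0 → b ≡ 0 → c ≡ 0 → k * a ≡ l * b + m * c
  all-zero k l m refl refl refl rewrite *-zeroʳ k | *-zeroʳ l | *-zeroʳ m = refl
  x-part : ∀ i → n ≢ i + r + j + j → Xₙ (dfib r n) i j ≡ 0
  x-part zero    _   = refl
  x-part (suc i) ne′ = dfib-support r n i j ne′
  pred-suc : ∀ {n m} → n ∸ 1 ≡ suc m → n ≡ suc (suc m)
  pred-suc {suc n} e = cong suc e
  y-part : ∀ j → n ≢ i + r + j + j → Yₙ (dfib r (n ∸ 1)) i j ≡ 0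
  y-part zero    _   = refl
  y-part (suc j) ne′ = dfib-support r (n ∸ 1) i j
    (λ e → ne′ (trans (pred-suc e) (sym (diagonal-step (i + r) j))))

dfib-recurrence : ∀ r n i j → 1 ≤ r →
  (n ∸ r) * dfib r (suc n) i j ≡ n * Xₙ (dfib r n) i j + (n + r) * Yₙ (dfib r (n ∸ 1)) i j
dfib-recurrence (suc r) n i j _ with n ≟ i + suc r + j + j
... | yes refl = recurrence-on-diagonal r i j
... | no  ne   = recurrence-off-diagonal (suc r) n i j ne

-- Case n < r of the theorem: every monomial lies below the diagonal.
derivative-vanishes : ∀ r n → n < r → ∂x^ r (F (n + 1)) ≈ 0P
derivative-vanishes r n n<r i j = begin
  ∂x^ r (F (n + 1)) i j   ≡⟨ shifted-coeff r n i j ⟩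
  + dfib r (suc n) i j    ≡⟨ cong +_ (dfib-support r (suc n) i j off-diagonal) ⟩
  + 0                     ≡⟨ sym (fib-coeff 0 i j) ⟩
  0P i j                  ∎
  where
  open ≡-Reasoning
  off-diagonal : suc n ≢ suc (i + r + j + j)
  off-diagonal e = <⇒≱ n<r (subst (r ≤_) (sym (suc-injective e)) (≤-diagonal i r j))

derivative-at-diagonal : ∀ r → ∂x^ r (F (r + 1)) ≈ const (+ (r !))
derivative-at-diagonal r zero zero = trans (shifted-coeff r r 0 0) (cong +_ value)
  where
  open ≡-Reasoning
  value : dfib r (suc r) 0 0 ≡ r !
  value = begin
    dfib r (suc r) 0 0                ≡⟨ cong (λ m → dfib r (suc m) 0 0) (sym (add-zeros r)) ⟩
    dfib r (suc (r + 0 + 0)) 0 0      ≡⟨ sym (*-identityʳ _) ⟩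
    dfib r (suc (r + 0 + 0)) 0 0 * 1  ≡⟨ dfib-diagonal r 0 0 ⟩
    (r + 0) !                         ≡⟨ cong _! (+-identityʳ r) ⟩
    r !                               ∎
    where
    add-zeros : ∀ r → r + 0 + 0 ≡ r
    add-zeros = solve-∀
derivative-at-diagonal r (suc i) j = trans (shifted-coeff r r (suc i) j)
  (cong +_ (dfib-support r (suc r) (suc i) j (λ e → <⇒≢ (s≤s (≤-diagonal i r j)) (suc-injective e))))
derivative-at-diagonal r zero (suc j) = trans (shifted-coeff r r zero (suc j))
  (cong +_ (dfib-support r (suc r) zero (suc j) (λ e → <⇒≢ above (suc-injective e))))
  where
  above : r < r + suc j + suc j
  above = <-≤-trans (m<m+n r (s≤s z≤n)) (m≤m+n (r + suc j) (suc j))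

derivative-recurrence : ∀ r n → 1 ≤ r →
  (+ (n ∸ r)) · ∂x^ r (F (n + 1)) ≈ (+ n) · X* (∂x^ r (F n)) ⊕ (+ (n + r)) · Y* (∂x^ r (F (n ∸ 1)))
derivative-recurrence r n 1≤r i j = begin
  + (n ∸ r) ℤ.* ∂x^ r (F (n + 1)) i j
    ≡⟨ cong (+ (n ∸ r) ℤ.*_) (shifted-coeff r n i j) ⟩
  + (n ∸ r) ℤ.* + dfib r (suc n) i j
    ≡⟨ sym (pos-* (n ∸ r) _) ⟩
  + ((n ∸ r) * dfib r (suc n) i j)
    ≡⟨ cong +_ (dfib-recurrence r n i j 1≤r) ⟩
  + (n * X + (n + r) * Y)
    ≡⟨ pos-+ (n * X) ((n + r) * Y) ⟩
  + (n * X) ℤ.+ + ((n + r) * Y)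
    ≡⟨ cong₂ ℤ._+_ (pos-* n X) (pos-* (n + r) Y) ⟩
  + n ℤ.* + X ℤ.+ + (n + r) ℤ.* + Y
    ≡⟨ sym (cong₂ (λ a b → + n ℤ.* a ℤ.+ + (n + r) ℤ.* b)
             (X*-natural (dfib-coeff r n) i j) (Y*-natural (dfib-coeff r (n ∸ 1)) i j)) ⟩
  + n ℤ.* X* (∂x^ r (F n)) i j ℤ.+ + (n + r) ℤ.* Y* (∂x^ r (F (n ∸ 1))) i j
    ∎
  where
  open ≡-Reasoning
  X = Xₙ (dfib r n) i j
  Y = Yₙ (dfib r (n ∸ 1)) i j

mainTheorem7 : (r n : ℕ) → 1 ≤ r →
    (n < r → ∂x^ r (F (n + 1)) ≈ 0P)
    × (n ≡ r → ∂x^ r (F (n + 1)) ≈ const (+ (r !)))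
    × (r < n → (+ (n ∸ r)) · ∂x^ r (F (n + 1))
                 ≈ (+ n) · X* (∂x^ r (F n)) ⊕ (+ (n + r)) · Y* (∂x^ r (F (n ∸ 1))))
mainTheorem7 r n 1≤r =
    derivative-vanishes r n
  , (λ { refl → derivative-at-diagonal r })
  , (λ _ → derivative-recurrence r n 1≤r)
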